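{- Let $n\ge 1$ and $m$ be integers with $0\le m\le \binom{n}{2}$. Write $m=\binom{n}{2}-\binom{s}{2}-t$ with integers $s\ge 1$, $0\le t<s$ (uniquely determined), and set \[ S(n,m)=\bigl(n(n-1)-2m\bigr)(s-1)+t(t+1)+4m(n-1)-(n-1)^2n. \] If $m\le n^2/4$, then \[ S(n,m)\le (n^2-2m)^{3/2}+4mn-n^3. \]
   Context: For $0\le m\le\binom n2$, the integers $s\ge1$ and $t$ with $\binom n2 - m=\binom{s}{2}+t$, $0\le t<s$, are uniquely determined. -}

module Defs where

open import Data.Nat as ℕ using (ℕ; _∸_)
open import Data.Integer using (ℤ; +_; _+_; _-_; _*_; _≤_; _^_; 0ℤ; 1ℤ)
open import Data.Sum using (_⊎_)

S : (n m s t : ℕ) → ℤ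
S n m s t =
  ((+ (n ℕ.* (n ∸ 1))) - (+ (2 ℕ.* m))) * ((+ s) - 1ℤ)
  + (+ (t ℕ.* (t ℕ.+ 1)))
  + (+ (4 ℕ.* m ℕ.* (n ∸ 1)))
  - ((+ (n ∸ 1)) ^ 2) * (+ n)

-- For an integer a and a natural b, "a ≤ b^(3/2)" (real 3/2-power of b ≥ 0):
-- holds iff a ≤ 0 or a² ≤ b³.
_≤^3/2_ : ℤ → ℕ → Set
a ≤^3/2 b = (a ≤ 0ℤ) ⊎ (a * a ≤ + (b ℕ.^ 3))

-- Put s = k + 1 and D = s(s − 1) + 2t, so that 2m + D = n(n − 1). Eliminating m, the left side
-- S − 4mn + n³ becomes L = D(s + 1) + t(t + 1) + n and the radicand n² − 2m becomes B = D + n;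
-- the claim is L² ≤ B³. Both L and B are n plus a quantity independent of n, and once l ≤ b^(3/2)
-- with b ≥ 1 the gap (b + j)^(3/2) − (l + j) grows with j, since x^(3/2) has slope ≥ 3/2 there.
-- So it suffices to take n = s + 1, where B³ − L² is a polynomial in t and s − 1 − t with
-- nonnegative coefficients. The case n = s forces m = t = 0 and gives L = s³, B = s², and n < s
-- is impossible.
module Submission where

open import Defs
open import Data.Nat using (ℕ; zero; suc; _+_; _*_; _^_; _∸_; _≤_; _<_)
open import Data.Nat.Combinatorics using (_C_)
open import Data.Integer using (+_) renaming (_+_ to _+ℤ_; _-_ to _-ℤ_)
open import Relation.Binary.PropositionalEquality using (_≡_)

open import Data.Nat using (z≤n; s≤s; z<s; >-nonZero)
open import Data.Nat.Combinatorics using (nCk+nC[k+1]≡[n+1]C[k+1]; nC1≡n)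
open import Data.Nat.Properties
open import Data.Nat.Tactic.RingSolver using (solve; solve-∀)
import Data.Integer as ℤ
import Data.Integer.Properties as ℤ
import Data.Integer.Tactic.RingSolver as ℤ-Solver
open import Data.List using (_∷_; [])
open import Data.Product using (_,_)
open import Data.Sum using (inj₂)
open import Relation.Binary using (tri<; tri≈; tri>)
open import Relation.Binary.PropositionalEquality using (refl; sym; trans; cong; cong₂; subst₂; module ≡-Reasoning)
open import Relation.Nullary using (contradiction)

2*[1+n]C2≡[1+n]*n : ∀ n → 2 * (suc n C 2) ≡ suc n * n
2*[1+n]C2≡[1+n]*n zero = refl
2*[1+n]C2≡[1+n]*n (suc n) = begin
  2 * (suc (suc n) C 2)         ≡⟨ cong (2 *_) (sym (nCk+nC[k+1]≡[n+1]C[k+1] (suc n) 1)) ⟩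
  2 * (suc n C 1 + suc n C 2)   ≡⟨ cong (λ x → 2 * (x + suc n C 2)) (nC1≡n (suc n)) ⟩
  2 * (suc n + suc n C 2)       ≡⟨ *-distribˡ-+ 2 (suc n) (suc n C 2) ⟩
  2 * suc n + 2 * (suc n C 2)   ≡⟨ cong (_+_ (2 * suc n)) (2*[1+n]C2≡[1+n]*n n) ⟩
  2 * suc n + suc n * n         ≡⟨ solve (n ∷ []) ⟩
  suc (suc n) * suc n           ∎
  where open ≡-Reasoning

-- With s = k + 1: deficit k t = s(s − 1) + 2t, which equals n(n − 1) − 2m; excess n k t and
-- radicand n k t are the values of S(n,m) − 4mn + n³ and n² − 2m.
deficit : ℕ → ℕ → ℕ
deficit k t = suc k * k + 2 * t

excess : ℕ → ℕ → ℕ → ℕ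
excess n k t = deficit k t * (k + 2) + t * (t + 1) + n

radicand : ℕ → ℕ → ℕ → ℕ
radicand n k t = deficit k t + n

2*m+deficit≡[1+p]*p : ∀ p m k t → m + suc k C 2 + t ≡ suc p C 2 → 2 * m + deficit k t ≡ suc p * p
2*m+deficit≡[1+p]*p p m k t eq = begin
  2 * m + (suc k * k + 2 * t)       ≡⟨ cong (λ x → 2 * m + (x + 2 * t)) (sym (2*[1+n]C2≡[1+n]*n k)) ⟩
  2 * m + (2 * (suc k C 2) + 2 * t) ≡⟨ 2*-distrib m (suc k C 2) t ⟩
  2 * (m + suc k C 2 + t)           ≡⟨ cong (2 *_) eq ⟩
  2 * (suc p C 2)                   ≡⟨ 2*[1+n]C2≡[1+n]*n p ⟩
  suc p * p                         ∎
  where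
  open ≡-Reasoning
  2*-distrib : ∀ a b c → 2 * a + (2 * b + 2 * c) ≡ 2 * (a + b + c)
  2*-distrib = solve-∀

n*n∸2*m≡radicand : ∀ p m k t → 2 * m + deficit k t ≡ suc p * p → suc p * suc p ∸ 2 * m ≡ radicand (suc p) k t
n*n∸2*m≡radicand p m k t rel = begin
  suc p * suc p ∸ 2 * m                 ≡⟨ cong (_∸ 2 * m) (solve (p ∷ [])) ⟩
  suc p * p + suc p ∸ 2 * m             ≡⟨ cong (λ x → x + suc p ∸ 2 * m) (sym rel) ⟩
  2 * m + deficit k t + suc p ∸ 2 * m   ≡⟨ cong (_∸ 2 * m) (+-assoc (2 * m) (deficit k t) (suc p)) ⟩
  2 * m + (deficit k t + suc p) ∸ 2 * m ≡⟨ m+n∸m≡n (2 * m) (deficit k t + suc p) ⟩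
  deficit k t + suc p                   ∎
  where open ≡-Reasoning

-- Only true modulo 2m + D = n(n − 1): adding 2(2m + D) on the left and 2n(n − 1) on the right
-- turns it into a polynomial identity.
S-4mn+n³≡excess-ℕ : ∀ p m D k t → 2 * m + D ≡ suc p * p →
  D * k + t * (t + 1) + 4 * m * p + suc p ^ 3 ≡ p * p * suc p + 4 * m * suc p + (D * (k + 2) + t * (t + 1) + suc p)
S-4mn+n³≡excess-ℕ p m D k t rel = +-cancelʳ-≡ (2 * (suc p * p)) _ _ (begin
  D * k + t * (t + 1) + 4 * m * p + suc p * (suc p * (suc p * 1)) + 2 * (suc p * p)
    ≡⟨ cong (λ x → D * k + t * (t + 1) + 4 * m * p + suc p * (suc p * (suc p * 1)) + 2 * x) (sym rel) ⟩
  D * k + t * (t + 1) + 4 * m * p + suc p * (suc p * (suc p * 1)) + 2 * (2 * m + D)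
    ≡⟨ solve (p ∷ m ∷ D ∷ k ∷ t ∷ []) ⟩
  p * p * suc p + 4 * m * suc p + (D * (k + 2) + t * (t + 1) + suc p) + 2 * (suc p * p) ∎)
  where open ≡-Reasoning

+[m+n]-+m≡+n : ∀ m n → + (m + n) -ℤ + m ≡ + n
+[m+n]-+m≡+n m n = trans (ℤ.[+m]-[+n]≡m⊖n (m + n) m) (trans (ℤ.⊖-≥ (m≤m+n m n)) (cong +_ (m+n∸m≡n m n)))

S-4mn+n³≡excess : ∀ p m k t → 2 * m + deficit k t ≡ suc p * p →
  (S (suc p) m (suc k) t -ℤ + (4 * m * suc p)) +ℤ + (suc p ^ 3) ≡ + excess (suc p) k t
S-4mn+n³≡excess p m k t rel = begin
  (((+ (n * p) -ℤ + (2 * m)) ℤ.* + k +ℤ c +ℤ e) -ℤ (+ p) ℤ.^ 2 ℤ.* + n) -ℤ f +ℤ g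
    ≡⟨ cong (λ x → ((x ℤ.* + k +ℤ c +ℤ e) -ℤ (+ p) ℤ.^ 2 ℤ.* + n) -ℤ f +ℤ g) difference ⟩
  ((+ d ℤ.* + k +ℤ c +ℤ e) -ℤ + p ℤ.* (+ p ℤ.* ℤ.1ℤ) ℤ.* + n) -ℤ f +ℤ g
    ≡⟨ regroup (+ d) (+ k) c e (+ p) (+ n) f g ⟩
  (+ d ℤ.* + k +ℤ c +ℤ e +ℤ g) -ℤ (+ p ℤ.* + p ℤ.* + n +ℤ f)
    ≡⟨ cong₂ (λ x y → (x +ℤ c +ℤ e +ℤ g) -ℤ (y +ℤ f)) (sym (ℤ.pos-* d k)) cubic-cast ⟩
  + (d * k + t * (t + 1) + 4 * m * p + n ^ 3) -ℤ + (p * p * n + 4 * m * n)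
    ≡⟨ cong (λ x → + x -ℤ + (p * p * n + 4 * m * n)) (S-4mn+n³≡excess-ℕ p m d k t rel) ⟩
  + (p * p * n + 4 * m * n + excess n k t) -ℤ + (p * p * n + 4 * m * n)
    ≡⟨ +[m+n]-+m≡+n (p * p * n + 4 * m * n) (excess n k t) ⟩
  + excess n k t ∎
  where
  open ≡-Reasoning
  n = suc p
  d = deficit k t
  c = + (t * (t + 1))
  e = + (4 * m * p)
  f = + (4 * m * n)
  g = + (n ^ 3)
  difference : + (n * p) -ℤ + (2 * m) ≡ + d
  difference = trans (cong (λ x → + x -ℤ + (2 * m)) (sym rel)) (+[m+n]-+m≡+n (2 * m) d)
  regroup : ∀ d k c e p n f g →
    ((d ℤ.* k +ℤ c +ℤ e) -ℤ p ℤ.* (p ℤ.* ℤ.1ℤ) ℤ.* n) -ℤ f +ℤ g ≡ (d ℤ.* k +ℤ c +ℤ e +ℤ g) -ℤ (p ℤ.* p ℤ.* n +ℤ f)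
  regroup = ℤ-Solver.solve-∀
  cubic-cast : + p ℤ.* + p ℤ.* + n ≡ + (p * p * n)
  cubic-cast = trans (cong (ℤ._* + n) (sym (ℤ.pos-* p p))) (sym (ℤ.pos-* (p * p) n))

l*l≤b*b*b⇒l≤b*b : ∀ {l b} → 0 < b → l * l ≤ b * b * b → l ≤ b * b
l*l≤b*b*b⇒l≤b*b {l} {b} 0<b l²≤b³ = ≮⇒≥ λ b²<l → <⇒≱ (*-mono-< b²<l b²<l) (begin
  l * l           ≤⟨ l²≤b³ ⟩
  b * b * b       ≤⟨ m≤m*n (b * b * b) b {{>-nonZero 0<b}} ⟩
  b * b * b * b   ≡⟨ solve (b ∷ []) ⟩
  b * b * (b * b) ∎)
  where open ≤-Reasoning

+-mono-square≤cube : ∀ {l b} j → 0 < b → l * l ≤ b * b * b → (l + j) * (l + j) ≤ (b + j) * (b + j) * (b + j)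
+-mono-square≤cube {l} {b} j 0<b l²≤b³ = begin
  (l + j) * (l + j)                                 ≡⟨ solve (l ∷ j ∷ []) ⟩
  l * l + (2 * l * j + j * j)                       ≤⟨ +-mono-≤ l²≤b³ (+-mono-≤ 2lj≤2b²j j²≤bj²) ⟩
  b * b * b + (2 * (b * b) * j + b * (j * j))       ≤⟨ m≤m+n _ (b * b * j + 2 * b * (j * j) + j * j * j) ⟩
  b * b * b + (2 * (b * b) * j + b * (j * j)) + (b * b * j + 2 * b * (j * j) + j * j * j)
                                                    ≡⟨ solve (b ∷ j ∷ []) ⟩
  (b + j) * (b + j) * (b + j)                       ∎
  where
  open ≤-Reasoning
  2lj≤2b²j : 2 * l * j ≤ 2 * (b * b) * j
  2lj≤2b²j = *-monoˡ-≤ j (*-monoʳ-≤ 2 (l*l≤b*b*b⇒l≤b*b {l} {b} 0<b l²≤b³))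
  j²≤bj² : j * j ≤ b * (j * j)
  j²≤bj² = m≤n*m (j * j) b {{>-nonZero 0<b}}

excess²≤radicand³-at-2+k : ∀ {k t} → t ≤ k →
  excess (2 + k) k t * excess (2 + k) k t ≤ radicand (2 + k) k t * radicand (2 + k) k t * radicand (2 + k) k t
excess²≤radicand³-at-2+k {t = t} t≤k with m≤n⇒∃[o]m+o≡n t≤k
... | u , refl = ≤-trans (m≤m+n _ _) (≤-reflexive (sym (certificate t u)))
  where
  -- The remainder is radicand³ − excess² written in t and u = k − t.
  certificate : ∀ t u →
    (suc (t + u) * (t + u) + 2 * t + (2 + (t + u))) * (suc (t + u) * (t + u) + 2 * t + (2 + (t + u)))
      * (suc (t + u) * (t + u) + 2 * t + (2 + (t + u)))
    ≡ ((suc (t + u) * (t + u) + 2 * t) * (t + u + 2) + t * (t + 1) + (2 + (t + u)))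
      * ((suc (t + u) * (t + u) + 2 * t) * (t + u + 2) + t * (t + 1) + (2 + (t + u)))
      + (4 + t * (16 + t * (20 + t * (12 + t * 2)))
        + u * (12 + t * (40 + t * (40 + t * (18 + t * 2)))
        + u * (15 + t * (36 + t * (26 + t * 6))
        + u * (10 + t * (14 + t * 6)
        + u * (3 + t * 2)))))
  certificate = solve-∀

excess²≤radicand³-at-1+k : ∀ {k m t} → 2 * m + deficit k t ≡ suc k * k →
  excess (suc k) k t * excess (suc k) k t ≤ radicand (suc k) k t * radicand (suc k) k t * radicand (suc k) k t
excess²≤radicand³-at-1+k {k} {m} {zero} _ = ≤-reflexive (perfect-cube k)
  where
  perfect-cube : ∀ k → ((suc k * k + 2 * 0) * (k + 2) + 0 * (0 + 1) + suc k) * ((suc k * k + 2 * 0) * (k + 2) + 0 * (0 + 1) + suc k)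
    ≡ (suc k * k + 2 * 0 + suc k) * (suc k * k + 2 * 0 + suc k) * (suc k * k + 2 * 0 + suc k)
  perfect-cube = solve-∀
excess²≤radicand³-at-1+k {k} {m} {suc t} rel = contradiction rel (>⇒≢ (begin-strict
  suc k * k                       <⟨ m<m+n (suc k * k) z<s ⟩
  suc k * k + 2 * suc t           ≤⟨ m≤n+m (suc k * k + 2 * suc t) (2 * m) ⟩
  2 * m + (suc k * k + 2 * suc t) ∎))
  where open ≤-Reasoning

excess²≤radicand³ : ∀ p m k t → t ≤ k → 2 * m + deficit k t ≡ suc p * p →
  excess (suc p) k t * excess (suc p) k t ≤ radicand (suc p) k t * radicand (suc p) k t * radicand (suc p) k t
excess²≤radicand³ p m k t t≤k rel with <-cmp p k
... | tri< p<k _ _ = contradiction rel (>⇒≢ (begin-strict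
  suc p * p                   <⟨ *-mono-< (s≤s p<k) p<k ⟩
  suc k * k                   ≤⟨ m≤m+n (suc k * k) (2 * t) ⟩
  suc k * k + 2 * t           ≤⟨ m≤n+m (suc k * k + 2 * t) (2 * m) ⟩
  2 * m + (suc k * k + 2 * t) ∎))
  where open ≤-Reasoning
... | tri≈ _ refl _ = excess²≤radicand³-at-1+k {k} {m} {t} rel
... | tri> _ _ k<p with m≤n⇒∃[o]m+o≡n k<p
...   | j , refl = subst₂ (λ l b → l * l ≤ b * b * b)
                     (+-assoc (deficit k t * (k + 2) + t * (t + 1)) (2 + k) j) (+-assoc (deficit k t) (2 + k) j)
                     (+-mono-square≤cube {l = excess (2 + k) k t} j 0<radicand (excess²≤radicand³-at-2+k t≤k))
  where
  0<radicand : 0 < radicand (2 + k) k t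
  0<radicand = ≤-trans (s≤s z≤n) (m≤n+m (2 + k) (deficit k t))

square≤cube⇒≤^3/2 : ∀ {l b} → l * l ≤ b * b * b → (+ l) ≤^3/2 b
square≤cube⇒≤^3/2 {l} {b} l²≤b³ = inj₂ (subst₂ ℤ._≤_ (ℤ.pos-* l l) (cong +_ (sym (cube b))) (ℤ.+≤+ l²≤b³))
  where
  cube : ∀ b → b * (b * (b * 1)) ≡ b * b * b
  cube = solve-∀

lemma6 : (n m s t : ℕ) → 1 ≤ n → 1 ≤ s → t < s
    → m + s C 2 + t ≡ n C 2
    → 4 * m ≤ n * n
    → ((S n m s t -ℤ (+ (4 * m * n))) +ℤ (+ (n ^ 3))) ≤^3/2 (n * n ∸ 2 * m)
lemma6 (suc p) m (suc k) t (s≤s z≤n) (s≤s z≤n) (s≤s t≤k) binomial _ =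
  subst₂ _≤^3/2_ (sym (S-4mn+n³≡excess p m k t rel)) (sym (n*n∸2*m≡radicand p m k t rel))
    (square≤cube⇒≤^3/2 {b = radicand (suc p) k t} (excess²≤radicand³ p m k t t≤k rel))
  where
  rel : 2 * m + deficit k t ≡ suc p * p
  rel = 2*m+deficit≡[1+p]*p p m k t binomial
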